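{- There exists $c_0\in\omega$ such that for all $m,k\in\omega$ there exist $p\in\omega$ and a term $\pi(z_0,\dots,z_{m-1},w)$ of $\mathcal M$ of length at most $c_0m$ such that for every propositional formula $P(x_0,\dots,x_{k-1},y_0,\dots,y_{m-1})$ of $\mathcal M$ there exists a propositional formula $Q(x,y)$ of $\mathcal M$ with the following property: for all $d\in\omega$, if $q>d+p$ then for all $a_0,\dots,a_{m-1}\in\mathbf M_d$, $$\mathbf M_d\models\exists x_0,\dots,x_{k-1}\,P(x_0,\dots,x_{k-1},a_0,\dots,a_{m-1})\iff\mathbf M_q\models\exists x\,Q(x,\pi(a_0,\dots,a_{m-1},d)).$$
   Context: $\mathcal M$ is the first-order language with equality with constants $\mathbf 0,\mathbf 1,-\mathbf 1,\mathbf n$, unary $\mathcal N,\mathbf p$, binary $+,\times,\div,\max,\min,\cap$; $\mathbf M_d$ ($n=2^d$) has universe $\{0,\dots,2^n-1\}$ with $+,\times$ mod $2^n$, $\mathbf p(x)=\min\{2^x,2^n-1\}$, $\div(x,y)=\lfloor x/y\rfloor$ ($0$ for $y=0$), constants $0,1,n,2^n-1$, usual $\max,\min$, bitwise AND $\cap$ and bitwise complement $\mathcal N$. A propositional formula is a quantifier-free formula. The length of a term is its total number of symbols. -}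

module Defs where

open import Data.Nat using (ℕ; zero; suc; _+_; _*_; _∸_; _^_; _<_; _⊔_; _⊓_)
open import Data.Nat.DivMod using (_/_; _%_)
import Data.Fin as Fin
open Fin using (Fin)
open import Data.Sum using (_⊎_; inj₁; inj₂)
open import Data.Product using (Σ; _×_)
open import Relation.Binary.PropositionalEquality using (_≡_)
open import Relation.Nullary using (¬_)

data Term (V : Set) : Set where
  var   : V → Term V
  c0 c1 cm1 cn : Term V
  𝒩 𝐩   : Term V → Term V
  plus times div max min cap : Term V → Term V → Term V

len : {V : Set} → Term V → ℕ
len (var _) = 1
len c0 = 1
len c1 = 1
len cm1 = 1
len cn = 1
len (𝒩 t) = suc (len t)
len (𝐩 t) = suc (len t)
len (plus s t) = suc (len s + len t)
len (times s t) = suc (len s + len t)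
len (div s t) = suc (len s + len t)
len (max s t) = suc (len s + len t)
len (min s t) = suc (len s + len t)
len (cap s t) = suc (len s + len t)

data Formula (V : Set) : Set where
  _≐_  : Term V → Term V → Formula V
  ¬'_  : Formula V → Formula V
  _∧'_ _∨'_ _⇒'_ : Formula V → Formula V → Formula V

-- The structures 𝐌_d, with universe {0,…,2^n−1} ⊆ ℕ, n = 2^d

nOf : ℕ → ℕ
nOf d = 2 ^ d

size : ℕ → ℕ
size d = 2 ^ nOf d

-- bitwise AND, with fuel (fuel ≥ number of bits suffices)
andF : ℕ → ℕ → ℕ → ℕ
andF zero    _ _ = 0
andF (suc f) x y = (x % 2) * (y % 2) + 2 * andF f (x / 2) (y / 2)

bitAnd : ℕ → ℕ → ℕ
bitAnd x y = andF x x y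

divZ : ℕ → ℕ → ℕ
divZ x zero    = 0
divZ x (suc y) = x / suc y

-- x mod y (y > 0 in all uses, since 2^n ≥ 1)
modZ : ℕ → ℕ → ℕ
modZ x zero    = x
modZ x (suc y) = x % suc y

module _ (d : ℕ) where
  private
    N : ℕ
    N = size d

  evalₘ : {V : Set} → (V → ℕ) → Term V → ℕ
  evalₘ ρ (var v) = ρ v
  evalₘ ρ c0 = 0
  evalₘ ρ c1 = 1
  evalₘ ρ cm1 = N ∸ 1
  evalₘ ρ cn = nOf d
  evalₘ ρ (𝒩 t) = (N ∸ 1) ∸ evalₘ ρ t
  evalₘ ρ (𝐩 t) = (2 ^ evalₘ ρ t) ⊓ (N ∸ 1)
  evalₘ ρ (plus s t) = modZ (evalₘ ρ s + evalₘ ρ t) N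
  evalₘ ρ (times s t) = modZ (evalₘ ρ s * evalₘ ρ t) N
  evalₘ ρ (div s t) = divZ (evalₘ ρ s) (evalₘ ρ t)
  evalₘ ρ (max s t) = evalₘ ρ s ⊔ evalₘ ρ t
  evalₘ ρ (min s t) = evalₘ ρ s ⊓ evalₘ ρ t
  evalₘ ρ (cap s t) = bitAnd (evalₘ ρ s) (evalₘ ρ t)

  Sat : {V : Set} → (V → ℕ) → Formula V → Set
  Sat ρ (s ≐ t) = evalₘ ρ s ≡ evalₘ ρ t
  Sat ρ (¬' φ) = ¬ Sat ρ φ
  Sat ρ (φ ∧' ψ) = Sat ρ φ × Sat ρ ψ
  Sat ρ (φ ∨' ψ) = Sat ρ φ ⊎ Sat ρ ψ
  Sat ρ (φ ⇒' ψ) = Sat ρ φ → Sat ρ ψ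

Elem : ℕ → ℕ → Set
Elem d a = a < size d

[_,_]ᵥ : {A B : Set} → (A → ℕ) → (B → ℕ) → (A ⊎ B) → ℕ
[ f , g ]ᵥ (inj₁ a) = f a
[ f , g ]ᵥ (inj₂ b) = g b

⟨_,_⟩₂ : ℕ → ℕ → Fin 2 → ℕ
⟨ a , b ⟩₂ Fin.zero = a
⟨ a , b ⟩₂ (Fin.suc Fin.zero) = b

module Submission where

-- The structure 𝐌_q, q > d + m + k, has 2^(2^q) elements: enough room for d, for the whole of 𝐌_d
-- (N = 2^(2^d) elements, with N² ≤ 2^(2^q)), and for base-N numerals of length m + k.  The term π
-- packs the parameters into d + A·K, where A is the base-N numeral with digits a₀, …, a_{m-1} and
-- K = 2^(2^(q-1)) = 𝐩(n ÷ 2) exceeds both d and A.  The formula Q reads off d = π mod K,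
-- N = 𝐩(𝐩(d)), the aᵢ as base-N digits of π ÷ K and the k witnesses as base-N digits of the single
-- variable x, and then evaluates P with each operation of 𝐌_d simulated in 𝐌_q: sums and products
-- do not overflow in 𝐌_q and are reduced mod N, subtraction and mod are built from 𝒩, + and ÷.

open import Defs
open import Data.Nat using (ℕ; zero; suc; _+_; _*_; _∸_; _^_; _⊔_; _⊓_; _≤_; _<_; z≤n; s≤s; s≤s⁻¹; NonZero; >-nonZero)
open import Data.Nat.Properties
open import Data.Nat.DivMod
open import Data.Nat.Divisibility using (divides)
open import Data.Nat.GeneralisedArithmetic using (iterate)
open import Data.Fin using (Fin; toℕ) renaming (zero to fzero; suc to fsuc)
open import Data.Sum using (_⊎_; inj₁; inj₂)
open import Data.Unit using (⊤; tt)
open import Data.Product using (Σ; _×_; _,_)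
open import Data.Product.Function.NonDependent.Propositional using (_×-⇔_)
open import Data.Sum.Function.Propositional using (_⊎-⇔_)
open import Function.Base using (_∘_)
open import Function.Bundles using (_⇔_; mk⇔; Equivalence)
open import Function.Related.TypeIsomorphisms using (¬-cong-⇔; →-cong-⇔)
open import Relation.Binary.PropositionalEquality

2^-mono-< : ∀ {m n} → m < n → 2 ^ m < 2 ^ n
2^-mono-< = ^-monoʳ-< 2 (s≤s (s≤s z≤n))

n<2^n : ∀ n → n < 2 ^ n
n<2^n zero    = s≤s z≤n
n<2^n (suc n) = begin-strict
  suc n        ≤⟨ n<2^n n ⟩
  2 ^ n        <⟨ m<m+n (2 ^ n) (≤-trans (m^n>0 2 n) (m≤m+n (2 ^ n) 0)) ⟩
  2 * 2 ^ n    ∎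
  where open ≤-Reasoning

pred-< : ∀ {n} → 0 < n → n ∸ 1 < n
pred-< {suc n} _ = n<1+n n

[m+kn]%n≡m : ∀ {m} k {n} .{{_ : NonZero n}} → m < n → (m + k * n) % n ≡ m
[m+kn]%n≡m {m} k {n} m<n = trans ([m+kn]%n≡m%n m k n) (m<n⇒m%n≡m m<n)

[m+kn]/n≡k : ∀ {m} k {n} .{{_ : NonZero n}} → m < n → (m + k * n) / n ≡ k
[m+kn]/n≡k {m} k {n} m<n =
  trans (+-distrib-/-∣ʳ m (divides k refl)) (cong₂ _+_ (m<n⇒m/n≡0 m<n) (m*n/n≡m k n))

[m+kn]<n*n : ∀ {m k n} → m < n → k < n → m + k * n < n * n
[m+kn]<n*n {m} {k} {n} m<n k<n = begin-strict
  m + k * n    <⟨ +-monoˡ-< (k * n) m<n ⟩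
  n + k * n    ≤⟨ *-monoˡ-≤ n k<n ⟩
  n * n        ∎
  where open ≤-Reasoning

andF≤ : ∀ f x y → andF f x y ≤ x
andF≤ zero    x y = z≤n
andF≤ (suc f) x y = begin
  (x % 2) * (y % 2) + 2 * andF f (x / 2) (y / 2)
    ≤⟨ +-mono-≤ (*-monoʳ-≤ (x % 2) (s≤s⁻¹ (m%n<n y 2))) (*-monoʳ-≤ 2 (andF≤ f (x / 2) (y / 2))) ⟩
  (x % 2) * 1 + 2 * (x / 2)
    ≡⟨ cong₂ _+_ (*-identityʳ (x % 2)) (*-comm 2 (x / 2)) ⟩
  x % 2 + (x / 2) * 2
    ≡⟨ m≡m%n+[m/n]*n x 2 ⟨
  x ∎
  where open ≤-Reasoning

divZ≤ : ∀ x y → divZ x y ≤ x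
divZ≤ x zero    = z≤n
divZ≤ x (suc y) = m/n≤m x (suc y)

divZ≡/ : ∀ x y .{{_ : NonZero y}} → divZ x y ≡ x / y
divZ≡/ x (suc y) = refl

modZ≡% : ∀ x y .{{_ : NonZero y}} → modZ x y ≡ x % y
modZ≡% x (suc y) = refl

size-nonZero : ∀ d → NonZero (size d)
size-nonZero d = m^n≢0 2 (nOf d)

nOf<size : ∀ d → nOf d < size d
nOf<size d = n<2^n (nOf d)

n<size : ∀ d → d < size d
n<size d = <-trans (n<2^n d) (nOf<size d)

size-mono-≤ : ∀ {d e} → d ≤ e → size d ≤ size e
size-mono-≤ d≤e = ^-monoʳ-≤ 2 (^-monoʳ-≤ 2 d≤e)

size-mono-< : ∀ {d e} → d < e → size d < size e
size-mono-< d<e = 2^-mono-< (2^-mono-< d<e)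

size-suc : ∀ d → size (suc d) ≡ size d * size d
size-suc d = trans (cong (2 ^_) (cong (nOf d +_) (+-identityʳ (nOf d))))
                   (^-distribˡ-+-* 2 (nOf d) (nOf d))

size^≤size : ∀ d m → size d ^ m ≤ size (d + m)
size^≤size d m = begin
  size d ^ m        ≡⟨ ^-*-assoc 2 (nOf d) m ⟩
  2 ^ (nOf d * m)   ≤⟨ ^-monoʳ-≤ 2 (*-monoʳ-≤ (nOf d) (<⇒≤ (n<2^n m))) ⟩
  2 ^ (nOf d * 2 ^ m) ≡⟨ cong (2 ^_) (^-distribˡ-+-* 2 d m) ⟨
  size (d + m)      ∎
  where open ≤-Reasoning

+-<-size-suc : ∀ {d a b} → a < size d → b < size d → a + b < size (suc d)
+-<-size-suc {d} {a} {b} a< b< = begin-strict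
  a + b              <⟨ +-mono-< a< b< ⟩
  size d + size d    ≡⟨ trans (*-suc (size d) 1) (cong (size d +_) (*-identityʳ (size d))) ⟨
  size d * 2         ≤⟨ *-monoʳ-≤ (size d) (^-monoʳ-≤ 2 {1} (m^n>0 2 d)) ⟩
  size d * size d    ≡⟨ size-suc d ⟨
  size (suc d)       ∎
  where open ≤-Reasoning

*-<-size-suc : ∀ {d a b} → a < size d → b < size d → a * b < size (suc d)
*-<-size-suc {d} a< b< = subst (_ <_) (sym (size-suc d)) (*-mono-< a< b<)

evalₘ-< : ∀ q {V : Set} (ρ : V → ℕ) → (∀ v → ρ v < size q) → ∀ t → evalₘ q ρ t < size q
evalₘ-< q ρ ρ< = go
  where
  instance _ = size-nonZero q
  top< : size q ∸ 1 < size q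
  top< = pred-< (m^n>0 2 (nOf q))
  go : ∀ t → evalₘ q ρ t < size q
  go (var v)     = ρ< v
  go c0          = m^n>0 2 (nOf q)
  go c1          = 2^-mono-< (m^n>0 2 q)
  go cm1         = top<
  go cn          = nOf<size q
  go (𝒩 t)       = ≤-<-trans (m∸n≤m _ (evalₘ q ρ t)) top<
  go (𝐩 t)       = ≤-<-trans (m⊓n≤n _ _) top<
  go (plus s t)  = subst (_< size q) (sym (modZ≡% _ (size q))) (m%n<n _ (size q))
  go (times s t) = subst (_< size q) (sym (modZ≡% _ (size q))) (m%n<n _ (size q))
  go (div s t)   = ≤-<-trans (divZ≤ _ (evalₘ q ρ t)) (go s)
  go (max s t)   = ⊔-lub (go s) (go t)
  go (min s t)   = ≤-<-trans (m⊓n≤m _ _) (go s)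
  go (cap s t)   = ≤-<-trans (andF≤ (evalₘ q ρ s) _ (evalₘ q ρ t)) (go s)

-- Derived terms and base-N numerals

_∸ᵗ_ : {V : Set} → Term V → Term V → Term V
s ∸ᵗ t = 𝒩 (plus (𝒩 s) t)

_%ᵗ_ : {V : Set} → Term V → Term V → Term V
t %ᵗ n = t ∸ᵗ times (div t n) n

fromDigits : ℕ → (m : ℕ) → (Fin m → ℕ) → ℕ
fromDigits N zero    g = 0
fromDigits N (suc m) g = g fzero + fromDigits N m (g ∘ fsuc) * N

digit : (N : ℕ) .{{_ : NonZero N}} → ℕ → ℕ → ℕ
digit N i x = iterate (_/ N) x i % N

fromDigits-< : ∀ {N} m g → (∀ i → g i < N) → fromDigits N m g < N ^ m
fromDigits-< zero    g g< = s≤s z≤n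
fromDigits-< {N} (suc m) g g< = begin-strict
  g fzero + E * N    <⟨ +-monoˡ-< (E * N) (g< fzero) ⟩
  N + E * N          ≤⟨ *-monoˡ-≤ N (fromDigits-< m (g ∘ fsuc) (g< ∘ fsuc)) ⟩
  N ^ m * N          ≡⟨ *-comm (N ^ m) N ⟩
  N ^ suc m          ∎
  where
  open ≤-Reasoning
  E = fromDigits N m (g ∘ fsuc)

digit-fromDigits : ∀ {N} .{{_ : NonZero N}} m g → (∀ i → g i < N) →
                   ∀ i → digit N (toℕ i) (fromDigits N m g) ≡ g i
digit-fromDigits {N} (suc m) g g< fzero =
  [m+kn]%n≡m (fromDigits N m (g ∘ fsuc)) (g< fzero)
digit-fromDigits {N} (suc m) g g< (fsuc i) =
  trans (cong (λ x → iterate (_/ N) x (toℕ i) % N) ([m+kn]/n≡k (fromDigits N m (g ∘ fsuc)) (g< fzero)))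
        (digit-fromDigits m (g ∘ fsuc) (g< ∘ fsuc) i)

fromDigitsᵗ : {V : Set} → Term V → (m : ℕ) → (Fin m → Term V) → Term V
fromDigitsᵗ n zero    f = c0
fromDigitsᵗ n (suc m) f = plus (f fzero) (times (fromDigitsᵗ n m (f ∘ fsuc)) n)

digitᵗ : {V : Set} → Term V → ℕ → Term V → Term V
digitᵗ n i t = iterate (λ u → div u n) t i %ᵗ n

sizeᵗ : {V : Set} → Term V → Term V
sizeᵗ δ = 𝐩 (𝐩 δ)

module Evaluation (q : ℕ) {V : Set} (ρ : V → ℕ) (ρ< : ∀ v → ρ v < size q) where
  private
    instance _ = size-nonZero q
    M = size q

  ⟦_⟧ : Term V → ℕ
  ⟦_⟧ = evalₘ q ρ

  ⟦⟧< : ∀ t → ⟦ t ⟧ < M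
  ⟦⟧< = evalₘ-< q ρ ρ<

  ⟦plus⟧ : ∀ s t {a b} → ⟦ s ⟧ ≡ a → ⟦ t ⟧ ≡ b → a + b < M → ⟦ plus s t ⟧ ≡ a + b
  ⟦plus⟧ s t refl refl = trans (modZ≡% _ M) ∘ m<n⇒m%n≡m

  ⟦times⟧ : ∀ s t {a b} → ⟦ s ⟧ ≡ a → ⟦ t ⟧ ≡ b → a * b < M → ⟦ times s t ⟧ ≡ a * b
  ⟦times⟧ s t refl refl = trans (modZ≡% _ M) ∘ m<n⇒m%n≡m

  ⟦div⟧ : ∀ s t {c} → ⟦ t ⟧ ≡ c → .{{_ : NonZero c}} → ⟦ div s t ⟧ ≡ ⟦ s ⟧ / c
  ⟦div⟧ s t {c} refl = divZ≡/ ⟦ s ⟧ c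

  ⟦𝐩⟧ : ∀ t {a} → ⟦ t ⟧ ≡ a → 2 ^ a < M → ⟦ 𝐩 t ⟧ ≡ 2 ^ a
  ⟦𝐩⟧ t refl = m≤n⇒m⊓n≡m ∘ <⇒≤pred

  -- 𝒩 is x ↦ M − 1 − x, so 𝒩 (𝒩 s + t) = s − t as long as the sum does not wrap around.
  ⟦∸ᵗ⟧ : ∀ s t {a b} → ⟦ s ⟧ ≡ a → ⟦ t ⟧ ≡ b → b ≤ a → ⟦ s ∸ᵗ t ⟧ ≡ a ∸ b
  ⟦∸ᵗ⟧ s t refl refl t≤s = begin
    (M ∸ 1) ∸ ⟦ plus (𝒩 s) t ⟧     ≡⟨ cong ((M ∸ 1) ∸_) (⟦plus⟧ (𝒩 s) t refl refl no-wrap) ⟩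
    (M ∸ 1) ∸ ((M ∸ 1 ∸ a) + b)    ≡⟨ ∸-+-assoc (M ∸ 1) (M ∸ 1 ∸ a) b ⟨
    (M ∸ 1) ∸ (M ∸ 1 ∸ a) ∸ b      ≡⟨ cong (_∸ b) (m∸[m∸n]≡n a≤top) ⟩
    a ∸ b                          ∎
    where
    open ≡-Reasoning
    a = ⟦ s ⟧
    b = ⟦ t ⟧
    a≤top : a ≤ M ∸ 1
    a≤top = <⇒≤pred (⟦⟧< s)
    no-wrap : (M ∸ 1 ∸ a) + b < M
    no-wrap = ≤-<-trans (+-monoʳ-≤ (M ∸ 1 ∸ a) t≤s)
                (subst (_< M) (sym (m∸n+n≡m a≤top)) (pred-< (m^n>0 2 (nOf q))))

  ⟦%ᵗ⟧ : ∀ t n {c} → ⟦ n ⟧ ≡ c → .{{_ : NonZero c}} → ⟦ t %ᵗ n ⟧ ≡ ⟦ t ⟧ % c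
  ⟦%ᵗ⟧ t n {c} ⟦n⟧ = begin
    ⟦ t ∸ᵗ times (div t n) n ⟧     ≡⟨ ⟦∸ᵗ⟧ t (times (div t n) n) refl ⟦quot⟧ (m/n*n≤m ⟦ t ⟧ c) ⟩
    ⟦ t ⟧ ∸ ⟦ t ⟧ / c * c          ≡⟨ m%n≡m∸m/n*n ⟦ t ⟧ c ⟨
    ⟦ t ⟧ % c                      ∎
    where
    open ≡-Reasoning
    ⟦quot⟧ : ⟦ times (div t n) n ⟧ ≡ ⟦ t ⟧ / c * c
    ⟦quot⟧ = ⟦times⟧ (div t n) n (⟦div⟧ t n ⟦n⟧) ⟦n⟧ (≤-<-trans (m/n*n≤m ⟦ t ⟧ c) (⟦⟧< t))

  ⟦iterate-div⟧ : ∀ n {c} → ⟦ n ⟧ ≡ c → .{{_ : NonZero c}} →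
                  ∀ i t → ⟦ iterate (λ u → div u n) t i ⟧ ≡ iterate (_/ c) ⟦ t ⟧ i
  ⟦iterate-div⟧ n ⟦n⟧ zero    t = refl
  ⟦iterate-div⟧ n {c} ⟦n⟧ (suc i) t =
    trans (⟦iterate-div⟧ n ⟦n⟧ i (div t n)) (cong (λ x → iterate (_/ c) x i) (⟦div⟧ t n ⟦n⟧))

  ⟦digitᵗ⟧ : ∀ n {c} → ⟦ n ⟧ ≡ c → .{{_ : NonZero c}} → ∀ i t → ⟦ digitᵗ n i t ⟧ ≡ digit c i ⟦ t ⟧
  ⟦digitᵗ⟧ n {c} ⟦n⟧ i t =
    trans (⟦%ᵗ⟧ (iterate (λ u → div u n) t i) n ⟦n⟧) (%-congˡ (⟦iterate-div⟧ n ⟦n⟧ i t))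

  ⟦fromDigitsᵗ⟧ : ∀ n {c} → ⟦ n ⟧ ≡ c → ∀ m f → (∀ i → ⟦ f i ⟧ < c) → c ^ m ≤ M →
                  ⟦ fromDigitsᵗ n m f ⟧ ≡ fromDigits c m (⟦_⟧ ∘ f)
  ⟦fromDigitsᵗ⟧ n ⟦n⟧ zero    f f< c^m≤M = refl
  ⟦fromDigitsᵗ⟧ n {c} ⟦n⟧ (suc m) f f< c^m≤M =
    ⟦plus⟧ (f fzero) (times R n) refl ⟦R*n⟧ total<
    where
    R = fromDigitsᵗ n m (f ∘ fsuc)
    total< : fromDigits c (suc m) (⟦_⟧ ∘ f) < M
    total< = <-≤-trans (fromDigits-< (suc m) (⟦_⟧ ∘ f) f<) c^m≤M
    c^m≤c^[1+m] : c ^ m ≤ c ^ suc m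
    c^m≤c^[1+m] = m≤n*m (c ^ m) c {{>-nonZero (≤-<-trans z≤n (f< fzero))}}
    ⟦R⟧ : ⟦ R ⟧ ≡ fromDigits c m (⟦_⟧ ∘ f ∘ fsuc)
    ⟦R⟧ = ⟦fromDigitsᵗ⟧ n ⟦n⟧ m (f ∘ fsuc) (f< ∘ fsuc) (≤-trans c^m≤c^[1+m] c^m≤M)
    ⟦R*n⟧ : ⟦ times R n ⟧ ≡ fromDigits c m (⟦_⟧ ∘ f ∘ fsuc) * c
    ⟦R*n⟧ = ⟦times⟧ R n ⟦R⟧ ⟦n⟧ (≤-<-trans (m≤n+m _ ⟦ f fzero ⟧) total<)

  ⟦sizeᵗ⟧ : ∀ δ {d} → d < q → ⟦ δ ⟧ ≡ d → ⟦ sizeᵗ δ ⟧ ≡ size d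
  ⟦sizeᵗ⟧ δ {d} d<q ⟦δ⟧ =
    ⟦𝐩⟧ (𝐩 δ) (⟦𝐩⟧ δ ⟦δ⟧ (<-trans (nOf<size d) (size-mono-< d<q))) (size-mono-< d<q)

-- Simulating 𝐌_d inside 𝐌_q

greatestᵗ : {V : Set} → Term V → Term V
greatestᵗ δ = sizeᵗ δ ∸ᵗ c1

translate : {V W : Set} → Term W → (V → Term W) → Term V → Term W
translate δ σ (var v)     = σ v
translate δ σ c0          = c0
translate δ σ c1          = c1
translate δ σ cm1         = greatestᵗ δ
translate δ σ cn          = 𝐩 δ
translate δ σ (𝒩 t)       = greatestᵗ δ ∸ᵗ translate δ σ t
translate δ σ (𝐩 t)       = min (𝐩 (translate δ σ t)) (greatestᵗ δ)
translate δ σ (plus s t)  = plus (translate δ σ s) (translate δ σ t) %ᵗ sizeᵗ δ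
translate δ σ (times s t) = times (translate δ σ s) (translate δ σ t) %ᵗ sizeᵗ δ
translate δ σ (div s t)   = div (translate δ σ s) (translate δ σ t)
translate δ σ (max s t)   = max (translate δ σ s) (translate δ σ t)
translate δ σ (min s t)   = min (translate δ σ s) (translate δ σ t)
translate δ σ (cap s t)   = cap (translate δ σ s) (translate δ σ t)

translateF : {V W : Set} → Term W → (V → Term W) → Formula V → Formula W
translateF δ σ (s ≐ t)  = translate δ σ s ≐ translate δ σ t
translateF δ σ (¬' φ)   = ¬' translateF δ σ φ
translateF δ σ (φ ∧' ψ) = translateF δ σ φ ∧' translateF δ σ ψ
translateF δ σ (φ ∨' ψ) = translateF δ σ φ ∨' translateF δ σ ψ
translateF δ σ (φ ⇒' ψ) = translateF δ σ φ ⇒' translateF δ σ ψ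

module Simulation {d q : ℕ} (d<q : d < q) {W : Set} (ρ : W → ℕ) (ρ< : ∀ w → ρ w < size q)
                  (δ : Term W) (⟦δ⟧ : evalₘ q ρ δ ≡ d)
                  {V : Set} (σ : V → Term W) (ρd : V → ℕ) (ρd< : ∀ v → ρd v < size d)
                  (⟦σ⟧ : ∀ v → evalₘ q ρ (σ v) ≡ ρd v) where
  open Evaluation q ρ ρ<
  private
    instance _ = size-nonZero d
    N = size d
    M = size q
    tr = translate δ σ

  ⟦sizeᵗδ⟧ : ⟦ sizeᵗ δ ⟧ ≡ N
  ⟦sizeᵗδ⟧ = ⟦sizeᵗ⟧ δ d<q ⟦δ⟧

  ⟦greatestᵗ⟧ : ⟦ greatestᵗ δ ⟧ ≡ N ∸ 1
  ⟦greatestᵗ⟧ = ⟦∸ᵗ⟧ (sizeᵗ δ) c1 ⟦sizeᵗδ⟧ refl (m^n>0 2 (nOf d))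

  ⟦%ᵗsizeᵗδ⟧ : ∀ u {v} → ⟦ u ⟧ ≡ v → ⟦ u %ᵗ sizeᵗ δ ⟧ ≡ modZ v N
  ⟦%ᵗsizeᵗδ⟧ u ⟦u⟧ = trans (⟦%ᵗ⟧ u (sizeᵗ δ) ⟦sizeᵗδ⟧) (trans (%-congˡ ⟦u⟧) (sym (modZ≡% _ N)))

  <size-suc⇒<M : ∀ {x} → x < size (suc d) → x < M
  <size-suc⇒<M x< = <-≤-trans x< (size-mono-≤ d<q)

  ⟦translate⟧ : ∀ t → ⟦ tr t ⟧ ≡ evalₘ d ρd t
  ⟦translate⟧ (var v) = ⟦σ⟧ v
  ⟦translate⟧ c0 = refl
  ⟦translate⟧ c1 = refl
  ⟦translate⟧ cm1 = ⟦greatestᵗ⟧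
  ⟦translate⟧ cn = ⟦𝐩⟧ δ ⟦δ⟧ (<-trans (nOf<size d) (size-mono-< d<q))
  ⟦translate⟧ (𝒩 t) =
    ⟦∸ᵗ⟧ (greatestᵗ δ) (tr t) ⟦greatestᵗ⟧ (⟦translate⟧ t) (<⇒≤pred (evalₘ-< d ρd ρd< t))
  ⟦translate⟧ (𝐩 t) = begin
    (2 ^ ⟦ tr t ⟧ ⊓ (M ∸ 1)) ⊓ ⟦ greatestᵗ δ ⟧
      ≡⟨ cong₂ (λ u w → (2 ^ u ⊓ (M ∸ 1)) ⊓ w) (⟦translate⟧ t) ⟦greatestᵗ⟧ ⟩
    (2 ^ v ⊓ (M ∸ 1)) ⊓ (N ∸ 1)
      ≡⟨ ⊓-assoc (2 ^ v) (M ∸ 1) (N ∸ 1) ⟩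
    2 ^ v ⊓ ((M ∸ 1) ⊓ (N ∸ 1))
      ≡⟨ cong (2 ^ v ⊓_) (m≥n⇒m⊓n≡n (∸-monoˡ-≤ 1 (<⇒≤ (size-mono-< d<q)))) ⟩
    2 ^ v ⊓ (N ∸ 1) ∎
    where
    open ≡-Reasoning
    v = evalₘ d ρd t
  ⟦translate⟧ (plus s t) = ⟦%ᵗsizeᵗδ⟧ (plus (tr s) (tr t))
    (⟦plus⟧ (tr s) (tr t) (⟦translate⟧ s) (⟦translate⟧ t)
       (<size-suc⇒<M (+-<-size-suc {d} (evalₘ-< d ρd ρd< s) (evalₘ-< d ρd ρd< t))))
  ⟦translate⟧ (times s t) = ⟦%ᵗsizeᵗδ⟧ (times (tr s) (tr t))
    (⟦times⟧ (tr s) (tr t) (⟦translate⟧ s) (⟦translate⟧ t)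
       (<size-suc⇒<M (*-<-size-suc {d} (evalₘ-< d ρd ρd< s) (evalₘ-< d ρd ρd< t))))
  ⟦translate⟧ (div s t) = cong₂ divZ (⟦translate⟧ s) (⟦translate⟧ t)
  ⟦translate⟧ (max s t) = cong₂ _⊔_ (⟦translate⟧ s) (⟦translate⟧ t)
  ⟦translate⟧ (min s t) = cong₂ _⊓_ (⟦translate⟧ s) (⟦translate⟧ t)
  ⟦translate⟧ (cap s t) = cong₂ bitAnd (⟦translate⟧ s) (⟦translate⟧ t)

  Sat-translate : ∀ φ → Sat d ρd φ ⇔ Sat q ρ (translateF δ σ φ)
  Sat-translate (s ≐ t)  = mk⇔ (λ e → trans (⟦translate⟧ s) (trans e (sym (⟦translate⟧ t))))
                               (λ e → trans (sym (⟦translate⟧ s)) (trans e (⟦translate⟧ t)))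
  Sat-translate (¬' φ)   = ¬-cong-⇔ (Sat-translate φ)
  Sat-translate (φ ∧' ψ) = Sat-translate φ ×-⇔ Sat-translate ψ
  Sat-translate (φ ∨' ψ) = Sat-translate φ ⊎-⇔ Sat-translate ψ
  Sat-translate (φ ⇒' ψ) = →-cong-⇔ (Sat-translate φ) (Sat-translate ψ)

-- The parameter term π and the formula Q

sizePredᵗ : {V : Set} → Term V
sizePredᵗ = 𝐩 (div cn (plus c1 c1))

evalₘ-sizePredᵗ : ∀ e {V : Set} (ρ : V → ℕ) → (∀ v → ρ v < size (suc e)) →
                  evalₘ (suc e) ρ sizePredᵗ ≡ size e
evalₘ-sizePredᵗ e ρ ρ< = ⟦𝐩⟧ (div cn (plus c1 c1)) ⟦half⟧ (size-mono-< (n<1+n e))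
  where
  open Evaluation (suc e) ρ ρ<
  ⟦two⟧ : ⟦ plus c1 c1 ⟧ ≡ 2
  ⟦two⟧ = ⟦plus⟧ c1 c1 refl refl (<-≤-trans (s≤s (s≤s (s≤s z≤n))) (size-mono-≤ {1} {suc e} (s≤s z≤n)))
  ⟦half⟧ : ⟦ div cn (plus c1 c1) ⟧ ≡ nOf e
  ⟦half⟧ = trans (⟦div⟧ cn (plus c1 c1) ⟦two⟧)
                 (trans (/-congˡ (*-comm 2 (nOf e))) (m*n/n≡m (nOf e) 2))

dᵛ : {m : ℕ} → Term (Fin m ⊎ ⊤)
dᵛ = var (inj₂ tt)

πᵗ : (m : ℕ) → Term (Fin m ⊎ ⊤)
πᵗ m = plus dᵛ (times (fromDigitsᵗ (sizeᵗ dᵛ) m (var ∘ inj₁)) sizePredᵗ)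

len-fromDigitsᵗ : ∀ {V : Set} (n : Term V) m (g : Fin m → V) →
                  len (fromDigitsᵗ n m (var ∘ g)) ≡ 1 + m * (3 + len n)
len-fromDigitsᵗ n zero    g = refl
len-fromDigitsᵗ n (suc m) g rewrite len-fromDigitsᵗ n m (g ∘ fsuc) =
  cong (4 +_) (+-comm (m * (3 + len n)) (len n))

len-πᵗ : ∀ m → len (πᵗ m) ≤ 16 * (m ⊔ 1)
len-πᵗ m = begin
  len (πᵗ m)                 ≡⟨ cong (λ l → 3 + (l + 6)) (len-fromDigitsᵗ (sizeᵗ (dᵛ {m})) m inj₁) ⟩
  4 + (m * 6 + 6)            ≡⟨ cong (4 +_) (+-comm (m * 6) 6) ⟩
  10 + m * 6                 ≤⟨ +-mono-≤ (*-monoˡ-≤ 10 (m≤n⊔m m 1)) (*-monoˡ-≤ 6 (m≤m⊔n m 1)) ⟩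
  w * 10 + w * 6             ≡⟨ *-distribˡ-+ w 10 6 ⟨
  w * 16                     ≡⟨ *-comm w 16 ⟩
  16 * w                     ∎
  where
  open ≤-Reasoning
  w = m ⊔ 1

xᵛ yᵛ : Term (Fin 2)
xᵛ = var fzero
yᵛ = var (fsuc fzero)

δᵗ : Term (Fin 2)
δᵗ = yᵛ %ᵗ sizePredᵗ

σᵗ : {m k : ℕ} → Fin k ⊎ Fin m → Term (Fin 2)
σᵗ (inj₁ i) = digitᵗ (sizeᵗ δᵗ) (toℕ i) xᵛ
σᵗ (inj₂ j) = digitᵗ (sizeᵗ δᵗ) (toℕ j) (div yᵛ sizePredᵗ)

Qᶠ : {m k : ℕ} → Formula (Fin k ⊎ Fin m) → Formula (Fin 2)
Qᶠ = translateF δᵗ σᵗ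

module Reduction {m k : ℕ} (P : Formula (Fin k ⊎ Fin m)) {d e : ℕ} (d+m+k≤e : d + (m + k) ≤ e)
                 (a : Fin m → ℕ) (a< : ∀ i → a i < size d) where
  private
    instance
      _ = size-nonZero d
      _ = size-nonZero e
    q = suc e
    N = size d
    K = size e
    A = fromDigits N m a
    ρπ : Fin m ⊎ ⊤ → ℕ
    ρπ = [ a , (λ _ → d) ]ᵥ

    d≤e : d ≤ e
    d≤e = ≤-trans (m≤m+n d (m + k)) d+m+k≤e
    d<q : d < q
    d<q = s≤s d≤e
    K<size-q : K < size q
    K<size-q = size-mono-< (n<1+n e)
    N^≤K : ∀ {j} → j ≤ m + k → N ^ j ≤ K
    N^≤K j≤m+k = ≤-trans (size^≤size d _) (size-mono-≤ (≤-trans (+-monoʳ-≤ d j≤m+k) d+m+k≤e))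
    A<K : A < K
    A<K = <-≤-trans (fromDigits-< m a a<) (N^≤K (m≤m+n m k))
    d<K : d < K
    d<K = <-≤-trans (n<size d) (size-mono-≤ d≤e)
    d+AK<size-q : d + A * K < size q
    d+AK<size-q = subst (d + A * K <_) (sym (size-suc e)) ([m+kn]<n*n {k = A} d<K A<K)

    ρπ< : ∀ v → ρπ v < size q
    ρπ< (inj₁ i) = <-trans (a< i) (size-mono-< d<q)
    ρπ< (inj₂ _) = <-trans d<K K<size-q

  y : ℕ
  y = evalₘ q ρπ (πᵗ m)

  y≡ : y ≡ d + A * K
  y≡ = ⟦plus⟧ dᵛ (times E sizePredᵗ) refl
         (⟦times⟧ E sizePredᵗ ⟦E⟧ (evalₘ-sizePredᵗ e ρπ ρπ<) (≤-<-trans (m≤n+m (A * K) d) d+AK<size-q))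
         d+AK<size-q
    where
    open Evaluation q ρπ ρπ<
    E = fromDigitsᵗ (sizeᵗ dᵛ) m (var ∘ inj₁)
    ⟦E⟧ : ⟦ E ⟧ ≡ A
    ⟦E⟧ = ⟦fromDigitsᵗ⟧ (sizeᵗ dᵛ) (⟦sizeᵗ⟧ dᵛ d<q refl) m (var ∘ inj₁) a<
            (≤-trans (N^≤K (m≤m+n m k)) (<⇒≤ K<size-q))

  y<size : y < size q
  y<size = subst (_< size q) (sym y≡) d+AK<size-q

  Sat-Q : ∀ {x} → x < size q → ∀ xs → (∀ i → xs i < N) → (∀ i → digit N (toℕ i) x ≡ xs i) →
          Sat d [ xs , a ]ᵥ P ⇔ Sat q ⟨ x , y ⟩₂ (Qᶠ P)
  Sat-Q {x} x< xs xs< x-digits = Sat-translate P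
    where
    ρq< : ∀ v → ⟨ x , y ⟩₂ v < size q
    ρq< fzero        = x<
    ρq< (fsuc fzero) = y<size
    open Evaluation q ⟨ x , y ⟩₂ ρq<
    ⟦K⟧ : ⟦ sizePredᵗ ⟧ ≡ K
    ⟦K⟧ = evalₘ-sizePredᵗ e ⟨ x , y ⟩₂ ρq<
    ⟦δᵗ⟧ : ⟦ δᵗ ⟧ ≡ d
    ⟦δᵗ⟧ = trans (⟦%ᵗ⟧ yᵛ sizePredᵗ ⟦K⟧) (trans (%-congˡ y≡) ([m+kn]%n≡m A d<K))
    ⟦A⟧ : ⟦ div yᵛ sizePredᵗ ⟧ ≡ A
    ⟦A⟧ = trans (⟦div⟧ yᵛ sizePredᵗ ⟦K⟧) (trans (/-congˡ y≡) ([m+kn]/n≡k A d<K))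
    ⟦N⟧ : ⟦ sizeᵗ δᵗ ⟧ ≡ N
    ⟦N⟧ = ⟦sizeᵗ⟧ δᵗ d<q ⟦δᵗ⟧
    ρd< : ∀ v → [ xs , a ]ᵥ v < N
    ρd< (inj₁ i) = xs< i
    ρd< (inj₂ j) = a< j
    ⟦σᵗ⟧ : ∀ v → ⟦ σᵗ v ⟧ ≡ [ xs , a ]ᵥ v
    ⟦σᵗ⟧ (inj₁ i) = trans (⟦digitᵗ⟧ (sizeᵗ δᵗ) ⟦N⟧ (toℕ i) xᵛ) (x-digits i)
    ⟦σᵗ⟧ (inj₂ j) = trans (⟦digitᵗ⟧ (sizeᵗ δᵗ) ⟦N⟧ (toℕ j) (div yᵛ sizePredᵗ))
                          (trans (cong (digit N (toℕ j)) ⟦A⟧) (digit-fromDigits m a a< j))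
    open Simulation d<q ⟨ x , y ⟩₂ ρq< δᵗ ⟦δᵗ⟧ σᵗ [ xs , a ]ᵥ ρd< ⟦σᵗ⟧

  reduction : (Σ (Fin k → ℕ) λ xs → (∀ i → Elem d (xs i)) × Sat d [ xs , a ]ᵥ P)
            ⇔ (Σ ℕ λ x → Elem q x × Sat q ⟨ x , y ⟩₂ (Qᶠ P))
  reduction = mk⇔ encode decode
    where
    encode : (Σ (Fin k → ℕ) λ xs → (∀ i → Elem d (xs i)) × Sat d [ xs , a ]ᵥ P) →
             Σ ℕ λ x → Elem q x × Sat q ⟨ x , y ⟩₂ (Qᶠ P)
    encode (xs , xs< , sat) = x , x< , Equivalence.to (Sat-Q x< xs xs< (digit-fromDigits k xs xs<)) sat
      where
      x = fromDigits N k xs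
      x< : x < size q
      x< = <-≤-trans (fromDigits-< k xs xs<) (≤-trans (N^≤K (m≤n+m k m)) (<⇒≤ K<size-q))
    decode : (Σ ℕ λ x → Elem q x × Sat q ⟨ x , y ⟩₂ (Qᶠ P)) →
             Σ (Fin k → ℕ) λ xs → (∀ i → Elem d (xs i)) × Sat d [ xs , a ]ᵥ P
    decode (x , x< , sat) = xs , xs< , Equivalence.from (Sat-Q x< xs xs< (λ _ → refl)) sat
      where
      xs : Fin k → ℕ
      xs i = digit N (toℕ i) x
      xs< : ∀ i → xs i < N
      xs< i = m%n<n _ N

lemma39 : Σ ℕ λ c₀ → (m k : ℕ) →
    Σ ℕ λ p → Σ (Term (Fin m ⊎ ⊤)) λ π → len π ≤ c₀ * (m ⊔ 1) ×
    ((P : Formula (Fin k ⊎ Fin m)) → Σ (Formula (Fin 2)) λ Q →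
      (d q : ℕ) → d + p < q → (a : Fin m → ℕ) → (∀ i → Elem d (a i)) →
        ((Σ (Fin k → ℕ) λ xs → (∀ i → Elem d (xs i)) × Sat d [ xs , a ]ᵥ P)
          ⇔ (Σ ℕ λ x → Elem q x ×
               Sat q ⟨ x , evalₘ q [ a , (λ _ → d) ]ᵥ π ⟩₂ Q)))
lemma39 = 16 , λ m k → m + k , πᵗ m , len-πᵗ m , λ P → Qᶠ P ,
  λ { d (suc e) (s≤s d+m+k≤e) a a< → Reduction.reduction P d+m+k≤e a a< }
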